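{- Let $G$ be the $X$-flip of a path $P$ for a set $X\subseteq V(P)$. Let $\ell\ge 1$ and $m\ge 0$ be integers. If the first $\ell$ vertices of $P$ (in the order along $P$ starting from one of its ends) are in $X$ and $|X|\ge \ell+4m$, then $G$ has a pivot-minor isomorphic to $\overline{P_{\ell+m}}$.
   Context: For a graph $H$ and $Y\subseteq V(H)$, the $Y$-flip of $H$ is the graph on $V(H)$ obtained by complementing the edge relation between pairs of distinct vertices both in $Y$. $\overline{P_k}$ is the complement of the path on $k$ vertices. Local complementation: $G\ast x:=(V(G),E(G)\triangle\{yz:y,z\in N_G(x),y\neq z\})$; pivoting an edge $uv$: $G\wedge uv:=G\ast u\ast v\ast u$; a pivot-minor is obtained by a (possibly empty) sequence of vertex deletions and pivotings. -}

module Defs where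

open import Data.Nat using (ℕ; suc; _≡ᵇ_)
open import Data.Bool using (Bool; true; false; not; _∧_; _∨_; _xor_)
open import Data.Fin using (Fin; toℕ; punchIn)
open import Data.Fin.Subset using (Subset)
open import Data.Vec using (lookup)
open import Data.Product using (Σ; _×_)
open import Function.Bundles using (_↔_; Inverse)
open import Relation.Binary.PropositionalEquality using (_≡_)

-- A (finite, labelled) graph on vertex set Fin n, given by its Boolean
-- adjacency relation.  All graphs arising below are simple
-- (symmetric and irreflexive).
Graph : ℕ → Set
Graph n = Fin n → Fin n → Bool

_=ᵛ_ : ∀ {n} → Fin n → Fin n → Bool
i =ᵛ j = toℕ i ≡ᵇ toℕ j

pathGraph : (n : ℕ) → Graph n
pathGraph n i j = (suc (toℕ i) ≡ᵇ toℕ j) ∨ (suc (toℕ j) ≡ᵇ toℕ i)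

complement : ∀ {n} → Graph n → Graph n
complement G i j = not (G i j) ∧ not (i =ᵛ j)

coPath : (k : ℕ) → Graph k
coPath k = complement (pathGraph k)

flip : ∀ {n} → Graph n → Subset n → Graph n
flip H Y i j = H i j xor (lookup Y i ∧ lookup Y j ∧ not (i =ᵛ j))

localComp : ∀ {n} → Graph n → Fin n → Graph n
localComp G x y z = G y z xor (G x y ∧ G x z ∧ not (y =ᵛ z))

pivot : ∀ {n} → Graph n → Fin n → Fin n → Graph n
pivot G u v = localComp (localComp (localComp G u) v) u

delete : ∀ {n} → Graph (suc n) → Fin (suc n) → Graph n
delete G v i j = G (punchIn v i) (punchIn v j)

data PivotMinor : ∀ {m} → Graph m → ∀ {n} → Graph n → Set where
  pm-refl  : ∀ {n} {G : Graph n} → PivotMinor G G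
  pm-pivot : ∀ {m n} {H : Graph m} {G : Graph n} (u v : Fin n) →
             G u v ≡ true → PivotMinor H (pivot G u v) → PivotMinor H G
  pm-del   : ∀ {m n} {H : Graph m} {G : Graph (suc n)} (v : Fin (suc n)) →
             PivotMinor H (delete G v) → PivotMinor H G

Isomorphic : ∀ {m n} → Graph m → Graph n → Set
Isomorphic {m} {n} G H =
  Σ (Fin m ↔ Fin n) λ f →
    ∀ x y → H (Inverse.to f x) (Inverse.to f y) ≡ G x y

module Submission where

-- Encode the X-flip of a path by the 0/1 word w with wᵢ = 1 iff i ∈ X.  Pivoting an edge uv
-- and deleting u and v maps the flip of a path to the flip of a shorter path (pivot-flipOn),
-- which gives three rewriting rules on words, β̃ denoting β with its first letter toggled:
--   α 00 β ↦ α β,     α 10 β ↦ α β̃,     α c1y1 β ↦ α c̄y β̃.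
-- Keep a block 1ᴾ at the front with the budget 4T ≤ 4P + (number of 1s after the block).
-- While P < T there are at least four 1s after the block, and a look at the next seven
-- letters always finds rules that either shorten the word without losing any 1, or enlarge
-- the block by k while losing at most 4k 1s.  Starting from the first ℓ vertices this
-- reaches P ≥ T = ℓ + m; deleting all but the first T vertices leaves the path P_T with all
-- its vertices flipped, i.e. the complement of P_T.  If instead the last ℓ vertices lie in X,
-- reverse the path.

open import Defs
open import Data.Nat
  using (ℕ; zero; suc; _+_; _*_; _∸_; _≡ᵇ_; _≤_; _<_; _≥_; z≤n; s≤s; _≤?_)
import Data.Nat.Properties as ℕ
open import Data.Nat.Solver using (module +-*-Solver)
open import Data.Bool using (Bool; true; false; not; _∧_; _∨_; _xor_)
import Data.Bool.Properties as Bool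
open import Data.List using (List; []; _∷_; _++_; length; replicate; reverse; drop)
open import Data.List.Properties
  using (++-assoc; length-++; length-++-sucʳ; length-++-≤ˡ; unfold-reverse; length-reverse)
open import Data.Vec using (toList; lookup)
import Data.Vec as Vec
open import Data.Vec.Properties using (length-toList; []=⇒lookup)
open import Data.Fin using (Fin; toℕ; fromℕ; fromℕ<; punchIn; opposite; inject₁)
import Data.Fin.Properties as Fin
open import Data.Fin.Properties
  using (toℕ-injective; toℕ<n; toℕ-fromℕ; toℕ-fromℕ<; opposite-involutive; opposite-prop; opposite-suc)
open import Data.Fin.Subset using (Subset; _∈_; ∣_∣)
open import Data.Fin.Subset.Properties using (∣p∣≤n)
open import Data.Product using (Σ; Σ-syntax; _×_; _,_)
open import Data.Sum using (_⊎_; inj₁; inj₂; [_,_]′)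
open import Function using (_∘_)
open import Function.Construct.Identity using (↔-id)
open import Relation.Nullary using (yes; no)
open import Relation.Nullary.Decidable using (Dec; True; toWitness; map′; _×-dec_; dec-true; dec-false)
open import Relation.Binary.PropositionalEquality
  using (_≡_; _≢_; refl; sym; trans; cong; cong₂; subst; module ≡-Reasoning)

-- Boolean identities, decided by truth tables

BoolFun : ℕ → Set
BoolFun zero    = Bool
BoolFun (suc k) = Bool → BoolFun k

_≗ᵇ_ : ∀ {k} → BoolFun k → BoolFun k → Set
_≗ᵇ_ {zero}  a b = a ≡ b
_≗ᵇ_ {suc k} f g = ∀ x → f x ≗ᵇ g x

_≗ᵇ?_ : ∀ {k} (f g : BoolFun k) → Dec (f ≗ᵇ g)
_≗ᵇ?_ {zero}  a b = a Bool.≟ b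
_≗ᵇ?_ {suc k} f g =
  map′ (λ (t , f′) → λ { true → t ; false → f′ }) (λ h → h true , h false)
       ((f true ≗ᵇ? g true) ×-dec (f false ≗ᵇ? g false))

decide : ∀ {k} {f g : BoolFun k} → True (f ≗ᵇ? g) → f ≗ᵇ g
decide = toWitness

≡ᵇ-refl : ∀ n → (n ≡ᵇ n) ≡ true
≡ᵇ-refl n = dec-true (n ℕ.≟ n) refl

≢⇒≡ᵇ-false : ∀ {m n} → m ≢ n → (m ≡ᵇ n) ≡ false
≢⇒≡ᵇ-false {m} {n} = dec-false (m ℕ.≟ n)

≡ᵇ-sym : ∀ m n → (m ≡ᵇ n) ≡ (n ≡ᵇ m)
≡ᵇ-sym zero    zero    = refl
≡ᵇ-sym zero    (suc n) = refl
≡ᵇ-sym (suc m) zero    = refl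
≡ᵇ-sym (suc m) (suc n) = ≡ᵇ-sym m n

=ᵛ-refl : ∀ {n} (i : Fin n) → (i =ᵛ i) ≡ true
=ᵛ-refl i = ≡ᵇ-refl (toℕ i)

≢⇒=ᵛ-false : ∀ {n} {i j : Fin n} → i ≢ j → (i =ᵛ j) ≡ false
≢⇒=ᵛ-false i≢j = ≢⇒≡ᵇ-false (i≢j ∘ toℕ-injective)

=ᵛ-sym : ∀ {n} (i j : Fin n) → (i =ᵛ j) ≡ (j =ᵛ i)
=ᵛ-sym i j = ≡ᵇ-sym (toℕ i) (toℕ j)

=ᵛ-injective : ∀ {m n} {f : Fin m → Fin n} → (∀ {i j} → f i ≡ f j → i ≡ j) →
               ∀ i j → (f i =ᵛ f j) ≡ (i =ᵛ j)
=ᵛ-injective {f = f} inj i j with i Fin.≟ j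
... | yes refl = trans (=ᵛ-refl (f i)) (sym (=ᵛ-refl i))
... | no i≢j   = trans (≢⇒=ᵛ-false (i≢j ∘ inj)) (sym (≢⇒=ᵛ-false i≢j))

-- Pivot-minors up to pointwise equality

_≈_ : ∀ {n} → Graph n → Graph n → Set
G ≈ H = ∀ i j → G i j ≡ H i j

Undirected : ∀ {n} → Graph n → Set
Undirected G = ∀ i j → G i j ≡ G j i

-- Graphs are adjacency functions and there is no function extensionality, so pivot-minors
-- are taken up to _≈_.
_≼_ : ∀ {m n} → Graph m → Graph n → Set
H ≼ G = Σ[ H′ ∈ Graph _ ] PivotMinor H′ G × H′ ≈ H

localComp-cong : ∀ {n} {G G′ : Graph n} x → G ≈ G′ → localComp G x ≈ localComp G′ x
localComp-cong x G≈G′ y z rewrite G≈G′ y z | G≈G′ x y | G≈G′ x z = refl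

pivot-cong : ∀ {n} {G G′ : Graph n} u v → G ≈ G′ → pivot G u v ≈ pivot G′ u v
pivot-cong u v = localComp-cong u ∘ localComp-cong v ∘ localComp-cong u

PivotMinor-resp-≈ : ∀ {m n} {H : Graph m} {G G′ : Graph n} →
                    G ≈ G′ → PivotMinor H G′ → H ≼ G
PivotMinor-resp-≈ G≈G′ pm-refl = _ , pm-refl , G≈G′
PivotMinor-resp-≈ G≈G′ (pm-pivot u v uv p)
  with H′ , p′ , H′≈H ← PivotMinor-resp-≈ (pivot-cong u v G≈G′) p
  = H′ , pm-pivot u v (trans (G≈G′ u v) uv) p′ , H′≈H
PivotMinor-resp-≈ G≈G′ (pm-del v p)
  with H′ , p′ , H′≈H ← PivotMinor-resp-≈ (λ i j → G≈G′ (punchIn v i) (punchIn v j)) p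
  = H′ , pm-del v p′ , H′≈H

PivotMinor-trans : ∀ {k m n} {K : Graph k} {H : Graph m} {G : Graph n} →
                   PivotMinor K H → PivotMinor H G → PivotMinor K G
PivotMinor-trans K≤H pm-refl            = K≤H
PivotMinor-trans K≤H (pm-pivot u v uv p) = pm-pivot u v uv (PivotMinor-trans K≤H p)
PivotMinor-trans K≤H (pm-del v p)        = pm-del v (PivotMinor-trans K≤H p)

≼-trans : ∀ {k m n} {K : Graph k} {H : Graph m} {G : Graph n} → K ≼ H → H ≼ G → K ≼ G
≼-trans (K′ , K′≤H , K′≈K) (H′ , H′≤G , H′≈H)
  with K″ , K″≤H′ , K″≈K′ ← PivotMinor-resp-≈ H′≈H K′≤H
  = K″ , PivotMinor-trans K″≤H′ H′≤G , λ i j → trans (K″≈K′ i j) (K′≈K i j)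

≼-reflexive : ∀ {n} {H G : Graph n} → H ≈ G → H ≼ G
≼-reflexive H≈G = _ , pm-refl , λ i j → sym (H≈G i j)

≼-pivot : ∀ {n} {G : Graph n} {u v} → G u v ≡ true → pivot G u v ≼ G
≼-pivot uv = _ , pm-pivot _ _ uv pm-refl , λ _ _ → refl

≼-delete : ∀ {n} {G : Graph (suc n)} v → delete G v ≼ G
≼-delete v = _ , pm-del v pm-refl , λ _ _ → refl

-- (G ∗ u ∗ v ∗ u) y z unfolded, for y, z ∉ {u, v}, an edge uv and no loop at u.
pivot-identity : _≗ᵇ_ {6}
  (λ gyz guy guz gvy gvz e →
    let yz₁ = gyz xor (guy ∧ guz ∧ not e)
        vy₁ = gvy xor (guy ∧ true)
        vz₁ = gvz xor (guz ∧ true)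
        uy₂ = (guy xor false) xor (vy₁ ∧ true)
        uz₂ = (guz xor false) xor (vz₁ ∧ true)
    in (yz₁ xor (vy₁ ∧ vz₁ ∧ not e)) xor (uy₂ ∧ uz₂ ∧ not e))
  (λ gyz guy guz gvy gvz e → gyz xor (((guy ∧ gvz) xor (gvy ∧ guz)) ∧ not e))
pivot-identity = decide _

pivot-outside : ∀ {n} (G : Graph n) {u v y z} →
  G u u ≡ false → G u v ≡ true → G v u ≡ true →
  (u =ᵛ y) ≡ false → (v =ᵛ y) ≡ false → (u =ᵛ z) ≡ false → (v =ᵛ z) ≡ false →
  pivot G u v y z ≡ G y z xor (((G u y ∧ G v z) xor (G v y ∧ G u z)) ∧ not (y =ᵛ z))
pivot-outside G {u} {v} {y} {z} uu uv vu uy vy uz vz rewrite uu | uv | vu | uy | vy | uz | vz =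
  pivot-identity (G y z) (G u y) (G u z) (G v y) (G v z) (y =ᵛ z)

localComp-undirected : ∀ {n} {G : Graph n} → Undirected G → ∀ x → Undirected (localComp G x)
localComp-undirected {G = G} sym-G x y z
  rewrite sym-G y z | =ᵛ-sym y z | Bool.∧-comm (G x y) (G x z ∧ not (z =ᵛ y))
        | Bool.∧-assoc (G x z) (not (z =ᵛ y)) (G x y) | Bool.∧-comm (not (z =ᵛ y)) (G x y) = refl

pivot-undirected : ∀ {n} {G : Graph n} → Undirected G → ∀ u v → Undirected (pivot G u v)
pivot-undirected sym-G u v =
  localComp-undirected (localComp-undirected (localComp-undirected sym-G u) v) u

≈-by-≤ : ∀ {n} {G H : Graph n} → Undirected G → Undirected H →
         (∀ i j → toℕ i ≤ toℕ j → G i j ≡ H i j) → G ≈ H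
≈-by-≤ sym-G sym-H G≤H i j with ℕ.≤-total (toℕ i) (toℕ j)
... | inj₁ i≤j = G≤H i j i≤j
... | inj₂ j≤i = trans (sym-G i j) (trans (G≤H j i j≤i) (sym-H j i))

-- Reversing the vertex order

reverseᴳ : ∀ {n} → Graph n → Graph n
reverseᴳ G i j = G (opposite i) (opposite j)

opposite-injective : ∀ {n} {i j : Fin n} → opposite i ≡ opposite j → i ≡ j
opposite-injective {i = i} {j} eq =
  trans (sym (opposite-involutive i)) (trans (cong opposite eq) (opposite-involutive j))

punchIn-fromℕ : ∀ {n} (j : Fin n) → punchIn (fromℕ n) j ≡ inject₁ j
punchIn-fromℕ Fin.zero    = refl
punchIn-fromℕ (Fin.suc j) = cong Fin.suc (punchIn-fromℕ j)

punchIn-inject₁-fromℕ : ∀ {n} (k : Fin (suc n)) →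
                        punchIn (inject₁ k) (fromℕ n) ≡ fromℕ (suc n)
punchIn-inject₁-fromℕ Fin.zero            = refl
punchIn-inject₁-fromℕ {suc n} (Fin.suc k) = cong Fin.suc (punchIn-inject₁-fromℕ k)

punchIn-inject₁ : ∀ {n} (k : Fin (suc n)) (j : Fin n) →
                  punchIn (inject₁ k) (inject₁ j) ≡ inject₁ (punchIn k j)
punchIn-inject₁ Fin.zero    j           = refl
punchIn-inject₁ (Fin.suc k) Fin.zero    = refl
punchIn-inject₁ (Fin.suc k) (Fin.suc j) = cong Fin.suc (punchIn-inject₁ k j)

opposite-punchIn : ∀ {n} (k : Fin (suc n)) (j : Fin n) →
                   opposite (punchIn k j) ≡ punchIn (opposite k) (opposite j)
opposite-punchIn Fin.zero    j           = sym (punchIn-fromℕ (opposite j))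
opposite-punchIn (Fin.suc k) Fin.zero    = sym (punchIn-inject₁-fromℕ (opposite k))
opposite-punchIn (Fin.suc k) (Fin.suc j) =
  trans (cong inject₁ (opposite-punchIn k j)) (sym (punchIn-inject₁ (opposite k) (opposite j)))

localComp-reverse : ∀ {n} (G : Graph n) x →
                    reverseᴳ (localComp G x) ≈ localComp (reverseᴳ G) (opposite x)
localComp-reverse G x y z
  rewrite opposite-involutive x | =ᵛ-injective opposite-injective y z = refl

pivot-reverse : ∀ {n} (G : Graph n) u v →
                reverseᴳ (pivot G u v) ≈ pivot (reverseᴳ G) (opposite u) (opposite v)
pivot-reverse G u v y z =
  trans (localComp-reverse (localComp (localComp G u) v) u y z)
  (trans (localComp-cong (opposite u) (localComp-reverse (localComp G u) v) y z)
         (localComp-cong (opposite u) (localComp-cong (opposite v) (localComp-reverse G u)) y z))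

delete-reverse : ∀ {n} (G : Graph (suc n)) v →
                 reverseᴳ (delete G v) ≈ delete (reverseᴳ G) (opposite v)
delete-reverse G v i j = sym (cong₂ G (shift i) (shift j))
  where
  shift : ∀ i → opposite (punchIn (opposite v) i) ≡ punchIn v (opposite i)
  shift i = trans (opposite-punchIn (opposite v) i)
                  (cong (λ k → punchIn k (opposite i)) (opposite-involutive v))

PivotMinor-reverse : ∀ {m n} {H : Graph m} {G : Graph n} →
                     PivotMinor H G → reverseᴳ H ≼ reverseᴳ G
PivotMinor-reverse pm-refl = ≼-reflexive (λ _ _ → refl)
PivotMinor-reverse {G = G} (pm-pivot u v uv H≤G′) =
  ≼-trans (PivotMinor-reverse H≤G′) (≼-trans (≼-reflexive (pivot-reverse G u v)) (≼-pivot edge))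
  where
  edge : reverseᴳ G (opposite u) (opposite v) ≡ true
  edge rewrite opposite-involutive u | opposite-involutive v = uv
PivotMinor-reverse {G = G} (pm-del v H≤G′) =
  ≼-trans (PivotMinor-reverse H≤G′)
          (≼-trans (≼-reflexive (delete-reverse G v)) (≼-delete (opposite v)))

≼-reverse : ∀ {m n} {H : Graph m} {G : Graph n} → H ≼ G → reverseᴳ H ≼ reverseᴳ G
≼-reverse (H′ , H′≤G , H′≈H) =
  ≼-trans (≼-reflexive λ i j → sym (H′≈H (opposite i) (opposite j))) (PivotMinor-reverse H′≤G)

-- Flips of paths, with positions in ℕ

pathℕ : ℕ → ℕ → Bool
pathℕ x y = (suc x ≡ᵇ y) ∨ (suc y ≡ᵇ x)

pathℕ-sym : ∀ x y → pathℕ x y ≡ pathℕ y x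
pathℕ-sym x y = Bool.∨-comm (suc x ≡ᵇ y) (suc y ≡ᵇ x)

pathℕ-suc : ∀ i → pathℕ i (suc i) ≡ true
pathℕ-suc zero    = refl
pathℕ-suc (suc i) = pathℕ-suc i

flipOn : (ℕ → ℕ → Bool) → (ℕ → Bool) → ℕ → ℕ → Bool
flipOn H F x y = H x y xor (F x ∧ F y ∧ not (x ≡ᵇ y))

pivotOn : (ℕ → ℕ → Bool) → ℕ → ℕ → ℕ → ℕ → Bool
pivotOn A u v x y = A x y xor (((A u x ∧ A v y) xor (A v x ∧ A u y)) ∧ not (x ≡ᵇ y))

pivotedFlip : (ℕ → ℕ → Bool) → (ℕ → Bool) → ℕ → ℕ → ℕ → Bool
pivotedFlip H F u v x = ((F v ∧ H u x) xor (F u ∧ H v x)) xor F x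

pivotedBase : (ℕ → ℕ → Bool) → (ℕ → Bool) → ℕ → ℕ → ℕ → ℕ → Bool
pivotedBase H F u v x y = H x y xor
  ((((F v ∧ H u x ∧ H u y) xor (F u ∧ H v x ∧ H v y)) xor
    (not (F u ∧ F v) ∧ ((H u x ∧ H v y) xor (H v x ∧ H u y)))) ∧ not (x ≡ᵇ y))

-- Not a ring identity, since F u and F v enter squared.
pivot-flip-identity : _≗ᵇ_ {10}
  (λ hxy hux hvx huy hvy fx fy fu fv e →
    (hxy xor (fx ∧ fy ∧ not e)) xor
    ((((hux xor (fu ∧ fx ∧ true)) ∧ (hvy xor (fv ∧ fy ∧ true))) xor
      ((hvx xor (fv ∧ fx ∧ true)) ∧ (huy xor (fu ∧ fy ∧ true)))) ∧ not e))
  (λ hxy hux hvx huy hvy fx fy fu fv e →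
    (hxy xor ((((fv ∧ hux ∧ huy) xor (fu ∧ hvx ∧ hvy)) xor
              (not (fu ∧ fv) ∧ ((hux ∧ hvy) xor (hvx ∧ huy)))) ∧ not e)) xor
    ((((fv ∧ hux) xor (fu ∧ hvx)) xor fx) ∧ (((fv ∧ huy) xor (fu ∧ hvy)) xor fy) ∧ not e))
pivot-flip-identity = decide _

pivot-flipOn : ∀ (H : ℕ → ℕ → Bool) (F : ℕ → Bool) {u v x y} →
  (u ≡ᵇ x) ≡ false → (v ≡ᵇ x) ≡ false → (u ≡ᵇ y) ≡ false → (v ≡ᵇ y) ≡ false →
  pivotOn (flipOn H F) u v x y ≡ flipOn (pivotedBase H F u v) (pivotedFlip H F u v) x y
pivot-flipOn H F {u} {v} {x} {y} ux vx uy vy rewrite ux | vx | uy | vy =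
  pivot-flip-identity (H x y) (H u x) (H v x) (H u y) (H v y) (F x) (F y) (F u) (F v) (x ≡ᵇ y)

-- The values of f at positions ≥ n are irrelevant.
flipPath : (n : ℕ) → (ℕ → Bool) → Graph n
flipPath n f i j = flipOn pathℕ f (toℕ i) (toℕ j)

pathℕ-irrefl : ∀ x → pathℕ x x ≡ false
pathℕ-irrefl zero    = refl
pathℕ-irrefl (suc x) = pathℕ-irrefl x

flipPath-irrefl : ∀ {n} f (i : Fin n) → flipPath n f i i ≡ false
flipPath-irrefl f i rewrite pathℕ-irrefl (toℕ i) | ≡ᵇ-refl (toℕ i) =
  trans (cong (f (toℕ i) ∧_) (Bool.∧-zeroʳ (f (toℕ i)))) (Bool.∧-zeroʳ (f (toℕ i)))

flipPath-undirected : ∀ {n} f → Undirected (flipPath n f)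
flipPath-undirected f i j
  rewrite pathℕ-sym (toℕ i) (toℕ j) | ≡ᵇ-sym (toℕ i) (toℕ j)
        | sym (Bool.∧-assoc (f (toℕ i)) (f (toℕ j)) (not (toℕ j ≡ᵇ toℕ i)))
        | Bool.∧-comm (f (toℕ i)) (f (toℕ j))
        | Bool.∧-assoc (f (toℕ j)) (f (toℕ i)) (not (toℕ j ≡ᵇ toℕ i)) = refl

pathℕ-beyond : ∀ {m t} → t < m → pathℕ (suc m) t ≡ false
pathℕ-beyond {suc m} {zero}  _         = refl
pathℕ-beyond {suc m} {suc t} (s≤s t<m) = pathℕ-beyond t<m

pathℕ-last-opposite : ∀ {n} (j : Fin n) → pathℕ n (toℕ (opposite j)) ≡ pathℕ 0 (suc (toℕ j))
pathℕ-last-opposite {suc m} Fin.zero    rewrite toℕ-fromℕ m = trans (pathℕ-sym (suc m) m) (pathℕ-suc m)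
pathℕ-last-opposite {suc m} (Fin.suc j) rewrite opposite-suc j = pathℕ-beyond (toℕ<n (opposite j))

pathℕ-opposite : ∀ {n} (i j : Fin n) →
                 pathℕ (toℕ (opposite i)) (toℕ (opposite j)) ≡ pathℕ (toℕ i) (toℕ j)
pathℕ-opposite {suc n} Fin.zero    Fin.zero    rewrite toℕ-fromℕ n = pathℕ-irrefl n
pathℕ-opposite {suc n} Fin.zero    (Fin.suc j) rewrite toℕ-fromℕ n | opposite-suc j = pathℕ-last-opposite j
pathℕ-opposite {suc n} (Fin.suc i) Fin.zero    rewrite toℕ-fromℕ n | opposite-suc i =
  trans (pathℕ-sym _ n) (trans (pathℕ-last-opposite i) (pathℕ-sym 0 (suc (toℕ i))))
pathℕ-opposite {suc n} (Fin.suc i) (Fin.suc j) rewrite opposite-suc i | opposite-suc j = pathℕ-opposite i j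

reverse-flipPath : ∀ {n} {f g : ℕ → Bool} → (∀ (i : Fin n) → g (toℕ i) ≡ f (toℕ (opposite i))) →
                   reverseᴳ (flipPath n f) ≈ flipPath n g
reverse-flipPath {f = f} {g} g≡f∘opp i j
  rewrite pathℕ-opposite i j | =ᵛ-injective opposite-injective i j | g≡f∘opp i | g≡f∘opp j = refl

punchInℕ : ℕ → ℕ → ℕ
punchInℕ zero    x       = suc x
punchInℕ (suc i) zero    = zero
punchInℕ (suc i) (suc x) = suc (punchInℕ i x)

toℕ-punchIn : ∀ {n} (i : Fin (suc n)) (j : Fin n) →
              toℕ (punchIn i j) ≡ punchInℕ (toℕ i) (toℕ j)
toℕ-punchIn Fin.zero    j          = refl
toℕ-punchIn (Fin.suc i) Fin.zero    = refl
toℕ-punchIn (Fin.suc i) (Fin.suc j) = cong suc (toℕ-punchIn i j)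

punchInℕ-≡ᵇ : ∀ i x y → (punchInℕ i x ≡ᵇ punchInℕ i y) ≡ (x ≡ᵇ y)
punchInℕ-≡ᵇ zero    x       y       = refl
punchInℕ-≡ᵇ (suc i) zero    zero    = refl
punchInℕ-≡ᵇ (suc i) zero    (suc y) = refl
punchInℕ-≡ᵇ (suc i) (suc x) zero    = refl
punchInℕ-≡ᵇ (suc i) (suc x) (suc y) = punchInℕ-≡ᵇ i x y

punchInℕ-avoids : ∀ i x → (i ≡ᵇ punchInℕ i x) ≡ false
punchInℕ-avoids zero    x       = refl
punchInℕ-avoids (suc i) zero    = refl
punchInℕ-avoids (suc i) (suc x) = punchInℕ-avoids i x

-- Pivot on the edge between the positions i and j = punchInℕ i k and delete both; the remaining
-- positions are enumerated by punchInℕ i ∘ punchInℕ k.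
flipPath-reduction : ∀ {n} {f f′ : ℕ → Bool} {i k j} →
  i < suc (suc n) → k < suc n → punchInℕ i k ≡ j →
  flipOn pathℕ f i j ≡ true →
  (∀ {x y} → x ≤ y →
     flipOn (pivotedBase pathℕ f i j) (pivotedFlip pathℕ f i j)
            (punchInℕ i (punchInℕ k x)) (punchInℕ i (punchInℕ k y))
     ≡ flipOn pathℕ f′ x y) →
  flipPath n f′ ≼ flipPath (suc (suc n)) f
flipPath-reduction {n} {f} {f′} {i} {k} {j} i<2+n k<1+n ik≡j ij reduced =
  ≼-trans (≼-reflexive reduced-graph) (≼-trans (≼-delete d) (≼-trans (≼-delete u) (≼-pivot uv)))
  where
  open ≡-Reasoning
  G : Graph (suc (suc n))
  G = flipPath (suc (suc n)) f
  u : Fin (suc (suc n))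
  u = fromℕ< i<2+n
  d : Fin (suc n)
  d = fromℕ< k<1+n
  v : Fin (suc (suc n))
  v = punchIn u d
  e : ℕ → ℕ
  e x = punchInℕ i (punchInℕ k x)
  φ : Fin n → Fin (suc (suc n))
  φ a = punchIn u (punchIn d a)

  toℕ-u : toℕ u ≡ i
  toℕ-u = toℕ-fromℕ< i<2+n
  toℕ-d : toℕ d ≡ k
  toℕ-d = toℕ-fromℕ< k<1+n
  toℕ-v : toℕ v ≡ j
  toℕ-v = trans (toℕ-punchIn u d) (trans (cong₂ punchInℕ toℕ-u toℕ-d) ik≡j)
  toℕ-φ : ∀ a → toℕ (φ a) ≡ e (toℕ a)
  toℕ-φ a = trans (toℕ-punchIn u (punchIn d a))
                  (cong₂ punchInℕ toℕ-u (trans (toℕ-punchIn d a) (cong (λ k → punchInℕ k (toℕ a)) toℕ-d)))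

  i∉e : ∀ x → (i ≡ᵇ e x) ≡ false
  i∉e x = punchInℕ-avoids i _
  j∉e : ∀ x → (j ≡ᵇ e x) ≡ false
  j∉e x = trans (cong (_≡ᵇ e x) (sym ik≡j)) (trans (punchInℕ-≡ᵇ i k _) (punchInℕ-avoids k x))
  u∉φ : ∀ a → (u =ᵛ φ a) ≡ false
  u∉φ a = trans (cong₂ _≡ᵇ_ toℕ-u (toℕ-φ a)) (i∉e (toℕ a))
  v∉φ : ∀ a → (v =ᵛ φ a) ≡ false
  v∉φ a = trans (cong₂ _≡ᵇ_ toℕ-v (toℕ-φ a)) (j∉e (toℕ a))

  uv : G u v ≡ true
  uv = trans (cong₂ (flipOn pathℕ f) toℕ-u toℕ-v) ij
  vu : G v u ≡ true
  vu = trans (flipPath-undirected f v u) uv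

  pivoted-pair : ∀ a b → toℕ a ≤ toℕ b → flipPath n f′ a b ≡ pivot G u v (φ a) (φ b)
  pivoted-pair a b a≤b = sym (begin
    pivot G u v (φ a) (φ b)
      ≡⟨ pivot-outside G {u} {v} {φ a} {φ b} (flipPath-irrefl f u) uv vu
                       (u∉φ a) (v∉φ a) (u∉φ b) (v∉φ b) ⟩
    pivotOn (flipOn pathℕ f) (toℕ u) (toℕ v) (toℕ (φ a)) (toℕ (φ b))
      ≡⟨ cong₂ (λ p q → pivotOn (flipOn pathℕ f) p q (toℕ (φ a)) (toℕ (φ b))) toℕ-u toℕ-v ⟩
    pivotOn (flipOn pathℕ f) i j (toℕ (φ a)) (toℕ (φ b))
      ≡⟨ cong₂ (pivotOn (flipOn pathℕ f) i j) (toℕ-φ a) (toℕ-φ b) ⟩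
    pivotOn (flipOn pathℕ f) i j (e (toℕ a)) (e (toℕ b))
      ≡⟨ pivot-flipOn pathℕ f {i} {j} {e (toℕ a)} {e (toℕ b)}
                      (i∉e (toℕ a)) (j∉e (toℕ a)) (i∉e (toℕ b)) (j∉e (toℕ b)) ⟩
    flipOn (pivotedBase pathℕ f i j) (pivotedFlip pathℕ f i j) (e (toℕ a)) (e (toℕ b))
      ≡⟨ reduced a≤b ⟩
    flipPath n f′ a b ∎)

  reduced-graph : flipPath n f′ ≈ delete (delete (pivot G u v) u) d
  reduced-graph = ≈-by-≤ (flipPath-undirected f′)
    (λ a b → pivot-undirected (flipPath-undirected f) u v (φ a) (φ b)) pivoted-pair

-- The three reductions

-- skip₀₁ i enumerates ℕ without i and i + 1; skip₀₂ i enumerates ℕ without i and i + 2.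
skip₀₁ : ℕ → ℕ → ℕ
skip₀₁ i x = punchInℕ i (punchInℕ i x)

skip₀₂ : ℕ → ℕ → ℕ
skip₀₂ i x = punchInℕ i (punchInℕ (suc i) x)

-- Finite case analyses of the position of x and y relative to i; x ≤ y suffices by ≈-by-≤.
pivotedPath-00 : ∀ i {x y} → x ≤ y →
  pathℕ (skip₀₁ i x) (skip₀₁ i y) xor
  (((pathℕ i (skip₀₁ i x) ∧ pathℕ (suc i) (skip₀₁ i y)) xor
    (pathℕ (suc i) (skip₀₁ i x) ∧ pathℕ i (skip₀₁ i y))) ∧ not (x ≡ᵇ y))
  ≡ pathℕ x y
pivotedPath-00 zero {x} {y} _ rewrite Bool.∧-zeroʳ (pathℕ 1 (suc (suc x))) = Bool.xor-identityʳ (pathℕ x y)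
pivotedPath-00 (suc i) (s≤s x≤y) = pivotedPath-00 i x≤y
pivotedPath-00 (suc i)       {y = zero}        z≤n = Bool.∧-zeroʳ _
pivotedPath-00 (suc zero)    {y = suc zero}    z≤n = refl
pivotedPath-00 (suc zero)    {y = suc (suc y)} z≤n = refl
pivotedPath-00 (suc (suc i)) {y = suc zero}    z≤n = refl
pivotedPath-00 (suc (suc i)) {y = suc (suc y)} z≤n = refl

pivotedPath-10 : ∀ i {x y} → x ≤ y →
  pathℕ (skip₀₁ i x) (skip₀₁ i y) xor
  (((pathℕ (suc i) (skip₀₁ i x) ∧ pathℕ (suc i) (skip₀₁ i y)) xor
    ((pathℕ i (skip₀₁ i x) ∧ pathℕ (suc i) (skip₀₁ i y)) xor
     (pathℕ (suc i) (skip₀₁ i x) ∧ pathℕ i (skip₀₁ i y)))) ∧ not (x ≡ᵇ y))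
  ≡ pathℕ x y
pivotedPath-10 zero {y = zero}        z≤n = refl
pivotedPath-10 zero {y = suc zero}    z≤n = refl
pivotedPath-10 zero {y = suc (suc y)} z≤n = refl
pivotedPath-10 zero (s≤s _) = Bool.xor-identityʳ _
pivotedPath-10 (suc i) (s≤s x≤y) = pivotedPath-10 i x≤y
pivotedPath-10 (suc i)       {y = zero}        z≤n = Bool.∧-zeroʳ _
pivotedPath-10 (suc zero)    {y = suc zero}    z≤n = refl
pivotedPath-10 (suc zero)    {y = suc (suc y)} z≤n = refl
pivotedPath-10 (suc (suc i)) {y = suc zero}    z≤n = refl
pivotedPath-10 (suc (suc i)) {y = suc (suc y)} z≤n = refl

pivotedPath-1?1 : ∀ i {x y} → x ≤ y →
  pathℕ (skip₀₂ i x) (skip₀₂ i y) xor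
  (((pathℕ i (skip₀₂ i x) ∧ pathℕ i (skip₀₂ i y)) xor
    (pathℕ (suc (suc i)) (skip₀₂ i x) ∧ pathℕ (suc (suc i)) (skip₀₂ i y))) ∧ not (x ≡ᵇ y))
  ≡ pathℕ x y
pivotedPath-1?1 zero {y = zero}              z≤n       = refl
pivotedPath-1?1 zero {y = suc zero}          z≤n       = refl
pivotedPath-1?1 zero {y = suc (suc y)}       z≤n       = refl
pivotedPath-1?1 zero {y = suc zero}          (s≤s z≤n) = refl
pivotedPath-1?1 zero {y = suc (suc zero)}    (s≤s z≤n) = refl
pivotedPath-1?1 zero {y = suc (suc (suc y))} (s≤s z≤n) = refl
pivotedPath-1?1 zero (s≤s (s≤s _)) = Bool.xor-identityʳ _
pivotedPath-1?1 (suc i) (s≤s x≤y) = pivotedPath-1?1 i x≤y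
pivotedPath-1?1 (suc i)       {y = zero}        z≤n = Bool.∧-zeroʳ _
pivotedPath-1?1 (suc zero)    {y = suc zero}    z≤n = refl
pivotedPath-1?1 (suc zero)    {y = suc (suc y)} z≤n = refl
pivotedPath-1?1 (suc (suc i)) {y = suc zero}    z≤n = refl
pivotedPath-1?1 (suc (suc i)) {y = suc (suc y)} z≤n = refl

pathℕ-suc-skip₀₁ : ∀ i x → pathℕ (suc i) (skip₀₁ i x) ≡ (x ≡ᵇ i)
pathℕ-suc-skip₀₁ zero    zero    = refl
pathℕ-suc-skip₀₁ zero    (suc x) = refl
pathℕ-suc-skip₀₁ (suc i) zero    = refl
pathℕ-suc-skip₀₁ (suc i) (suc x) = pathℕ-suc-skip₀₁ i x

pathℕ-ends-skip₀₂ : ∀ i x →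
  pathℕ (suc i) (skip₀₂ (suc i) x) xor pathℕ (suc (suc (suc i))) (skip₀₂ (suc i) x)
  ≡ (x ≡ᵇ i) xor (x ≡ᵇ suc (suc i))
pathℕ-ends-skip₀₂ zero    zero          = refl
pathℕ-ends-skip₀₂ zero    (suc zero)    = refl
pathℕ-ends-skip₀₂ zero    (suc (suc zero))    = refl
pathℕ-ends-skip₀₂ zero    (suc (suc (suc x))) = refl
pathℕ-ends-skip₀₂ (suc i) zero                = refl
pathℕ-ends-skip₀₂ (suc i) (suc x)       = pathℕ-ends-skip₀₂ i x

toggleAt : ℕ → (ℕ → Bool) → ℕ → Bool
toggleAt i f x = (x ≡ᵇ i) xor f x

punchInℕ-≥ : ∀ {i x} → i ≤ x → punchInℕ i x ≡ suc x
punchInℕ-≥ {zero}              _         = refl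
punchInℕ-≥ {suc i} {suc x} (s≤s i≤x) = cong suc (punchInℕ-≥ i≤x)

pathℕ-suc-suc : ∀ i → pathℕ i (suc (suc i)) ≡ false
pathℕ-suc-suc zero    = refl
pathℕ-suc-suc (suc i) = pathℕ-suc-suc i

≡ᵇ-suc-suc : ∀ i → (i ≡ᵇ suc (suc i)) ≡ false
≡ᵇ-suc-suc zero    = refl
≡ᵇ-suc-suc (suc i) = ≡ᵇ-suc-suc i

punchInℕ²-≡ᵇ : ∀ i k x y → (punchInℕ i (punchInℕ k x) ≡ᵇ punchInℕ i (punchInℕ k y)) ≡ (x ≡ᵇ y)
punchInℕ²-≡ᵇ i k x y = trans (punchInℕ-≡ᵇ i _ _) (punchInℕ-≡ᵇ k x y)

reduce-00 : ∀ {n} (f : ℕ → Bool) {i} → i ≤ n → f i ≡ false → f (suc i) ≡ false →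
            flipPath n (f ∘ skip₀₁ i) ≼ flipPath (suc (suc n)) f
reduce-00 f {i} i≤n fi fi+1 =
  flipPath-reduction {f = f} {f′ = f ∘ skip₀₁ i}
    (s≤s (ℕ.m≤n⇒m≤1+n i≤n)) (s≤s i≤n) (punchInℕ-≥ ℕ.≤-refl) edge pair
  where
  edge : flipOn pathℕ f i (suc i) ≡ true
  edge rewrite pathℕ-suc i | fi = refl
  pair : ∀ {x y} → x ≤ y →
    flipOn (pivotedBase pathℕ f i (suc i)) (pivotedFlip pathℕ f i (suc i)) (skip₀₁ i x) (skip₀₁ i y)
    ≡ flipOn pathℕ (f ∘ skip₀₁ i) x y
  pair {x} {y} x≤y rewrite fi | fi+1 | punchInℕ²-≡ᵇ i i x y =
    cong (_xor (f (skip₀₁ i x) ∧ f (skip₀₁ i y) ∧ not (x ≡ᵇ y))) (pivotedPath-00 i x≤y)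

reduce-10 : ∀ {n} (f : ℕ → Bool) {i} → i ≤ n → f i ≡ true → f (suc i) ≡ false →
            flipPath n (toggleAt i (f ∘ skip₀₁ i)) ≼ flipPath (suc (suc n)) f
reduce-10 f {i} i≤n fi fi+1 =
  flipPath-reduction {f = f} {f′ = toggleAt i (f ∘ skip₀₁ i)}
    (s≤s (ℕ.m≤n⇒m≤1+n i≤n)) (s≤s i≤n) (punchInℕ-≥ ℕ.≤-refl) edge pair
  where
  edge : flipOn pathℕ f i (suc i) ≡ true
  edge rewrite pathℕ-suc i | fi | fi+1 = refl
  pair : ∀ {x y} → x ≤ y →
    flipOn (pivotedBase pathℕ f i (suc i)) (pivotedFlip pathℕ f i (suc i)) (skip₀₁ i x) (skip₀₁ i y)
    ≡ flipOn pathℕ (toggleAt i (f ∘ skip₀₁ i)) x y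
  pair {x} {y} x≤y rewrite fi | fi+1 | punchInℕ²-≡ᵇ i i x y =
    cong₂ _xor_ (pivotedPath-10 i x≤y) (cong₂ (λ p q → p ∧ q ∧ not (x ≡ᵇ y)) (toggled x) (toggled y))
    where
    toggled : ∀ z → pathℕ (suc i) (skip₀₁ i z) xor f (skip₀₁ i z) ≡ toggleAt i (f ∘ skip₀₁ i) z
    toggled z = cong (_xor f (skip₀₁ i z)) (pathℕ-suc-skip₀₁ i z)

reduce-1?1 : ∀ {n} (f : ℕ → Bool) {i} →
             suc (suc i) ≤ n → f (suc i) ≡ true → f (suc (suc (suc i))) ≡ true →
             flipPath n (toggleAt i (toggleAt (suc (suc i)) (f ∘ skip₀₂ (suc i)))) ≼ flipPath (suc (suc n)) f
reduce-1?1 f {i} i+2≤n fi+1 fi+3 =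
  flipPath-reduction {f = f} {f′ = toggleAt i (toggleAt (suc (suc i)) (f ∘ skip₀₂ (suc i)))}
    (s≤s (ℕ.m≤n⇒m≤1+n (ℕ.<⇒≤ i+2≤n))) (s≤s i+2≤n) (punchInℕ-≥ (ℕ.n≤1+n (suc i))) edge pair
  where
  edge : flipOn pathℕ f (suc i) (suc (suc (suc i))) ≡ true
  edge rewrite pathℕ-suc-suc (suc i) | fi+1 | fi+3 | ≡ᵇ-suc-suc i = refl
  pair : ∀ {x y} → x ≤ y →
    flipOn (pivotedBase pathℕ f (suc i) (suc (suc (suc i)))) (pivotedFlip pathℕ f (suc i) (suc (suc (suc i))))
           (skip₀₂ (suc i) x) (skip₀₂ (suc i) y)
    ≡ flipOn pathℕ (toggleAt i (toggleAt (suc (suc i)) (f ∘ skip₀₂ (suc i)))) x y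
  pair {x} {y} x≤y rewrite fi+1 | fi+3 | punchInℕ²-≡ᵇ (suc i) (suc (suc i)) x y =
    cong₂ _xor_ base (cong₂ (λ p q → p ∧ q ∧ not (x ≡ᵇ y)) (toggled x) (toggled y))
    where
    e : ℕ → ℕ
    e = skip₀₂ (suc i)
    base : pathℕ (e x) (e y) xor
           ((((pathℕ (suc i) (e x) ∧ pathℕ (suc i) (e y)) xor
              (pathℕ (suc (suc (suc i))) (e x) ∧ pathℕ (suc (suc (suc i))) (e y))) xor false) ∧ not (x ≡ᵇ y))
           ≡ pathℕ x y
    base = trans (cong (λ c → pathℕ (e x) (e y) xor (c ∧ not (x ≡ᵇ y))) (Bool.xor-identityʳ _))
                 (pivotedPath-1?1 (suc i) x≤y)
    toggled : ∀ z → (pathℕ (suc i) (e z) xor pathℕ (suc (suc (suc i))) (e z)) xor f (e z)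
                    ≡ toggleAt i (toggleAt (suc (suc i)) (f ∘ e)) z
    toggled z = trans (cong (_xor f (e z)) (pathℕ-ends-skip₀₂ i z)) (Bool.xor-assoc (z ≡ᵇ i) _ (f (e z)))

complement-pathℕ : ∀ x y → not (pathℕ x y) ∧ not (x ≡ᵇ y) ≡ pathℕ x y xor not (x ≡ᵇ y)
complement-pathℕ zero          zero          = refl
complement-pathℕ zero          (suc zero)    = refl
complement-pathℕ zero          (suc (suc y)) = refl
complement-pathℕ (suc zero)    zero          = refl
complement-pathℕ (suc (suc x)) zero          = refl
complement-pathℕ (suc x)       (suc y)       = complement-pathℕ x y

coPath≈flipPath : ∀ {T} {f : ℕ → Bool} → (∀ x → x < T → f x ≡ true) → coPath T ≈ flipPath T f
coPath≈flipPath all-true i j rewrite all-true (toℕ i) (toℕ<n i) | all-true (toℕ j) (toℕ<n j) =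
  complement-pathℕ (toℕ i) (toℕ j)

punchInℕ-< : ∀ {i x} → x < i → punchInℕ i x ≡ x
punchInℕ-< {suc i} {zero}  _         = refl
punchInℕ-< {suc i} {suc x} (s≤s x<i) = cong suc (punchInℕ-< x<i)

flipPath-≼-extend : ∀ k {m} (f : ℕ → Bool) → flipPath m f ≼ flipPath (k + m) f
flipPath-≼-extend zero    f = ≼-reflexive (λ _ _ → refl)
flipPath-≼-extend (suc k) {m} f =
  ≼-trans (flipPath-≼-extend k f) (≼-trans (≼-reflexive drop-last) (≼-delete (fromℕ (k + m))))
  where
  below-last : ∀ (i : Fin (k + m)) → toℕ (punchIn (fromℕ (k + m)) i) ≡ toℕ i
  below-last i = trans (toℕ-punchIn (fromℕ (k + m)) i)
                       (trans (cong (λ t → punchInℕ t (toℕ i)) (toℕ-fromℕ (k + m))) (punchInℕ-< (toℕ<n i)))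
  drop-last : flipPath (k + m) f ≈ delete (flipPath (suc (k + m)) f) (fromℕ (k + m))
  drop-last i j = sym (cong₂ (flipOn pathℕ f) (below-last i) (below-last j))

coPath-≼-flipPath : ∀ {T m} {f : ℕ → Bool} →
                    T ≤ m → (∀ x → x < T → f x ≡ true) → coPath T ≼ flipPath m f
coPath-≼-flipPath {T} {m} {f} T≤m all-true =
  subst (λ N → coPath T ≼ flipPath N f) (ℕ.m∸n+n≡m T≤m)
        (≼-trans (≼-reflexive (coPath≈flipPath all-true)) (flipPath-≼-extend (m ∸ T) f))

-- Words

infixl 10 _‼_
-- Indexing with default false beyond the end.
_‼_ : List Bool → ℕ → Bool
[]      ‼ _     = false
(b ∷ w) ‼ zero  = b
(b ∷ w) ‼ suc x = w ‼ x

wordGraph : (w : List Bool) → Graph (length w)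
wordGraph w = flipPath (length w) (w ‼_)

toggleHead : List Bool → List Bool
toggleHead []      = []
toggleHead (b ∷ w) = not b ∷ w

flipPath-cong : ∀ {n} {f g : ℕ → Bool} → (∀ x → x < n → f x ≡ g x) → flipPath n f ≈ flipPath n g
flipPath-cong f≗g i j rewrite f≗g (toℕ i) (toℕ<n i) | f≗g (toℕ j) (toℕ<n j) = refl

‼-skip₀₁ : ∀ α {a b} β x → (α ++ a ∷ b ∷ β) ‼ skip₀₁ (length α) x ≡ (α ++ β) ‼ x
‼-skip₀₁ []      β x       = refl
‼-skip₀₁ (c ∷ α) β zero    = refl
‼-skip₀₁ (c ∷ α) β (suc x) = ‼-skip₀₁ α β x

‼-skip₀₂ : ∀ α c {a} y {b} β x →
           (α ++ c ∷ a ∷ y ∷ b ∷ β) ‼ skip₀₂ (suc (length α)) x ≡ (α ++ c ∷ y ∷ β) ‼ x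
‼-skip₀₂ []      c y β zero          = refl
‼-skip₀₂ []      c y β (suc zero)    = refl
‼-skip₀₂ []      c y β (suc (suc x)) = refl
‼-skip₀₂ (d ∷ α) c y β zero          = refl
‼-skip₀₂ (d ∷ α) c y β (suc x)       = ‼-skip₀₂ α c y β x

‼-toggleHead : ∀ α β x → x < length (α ++ β) →
               (α ++ toggleHead β) ‼ x ≡ toggleAt (length α) ((α ++ β) ‼_) x
‼-toggleHead []      []      x       ()
‼-toggleHead []      (b ∷ β) zero    _         = refl
‼-toggleHead []      (b ∷ β) (suc x) _         = refl
‼-toggleHead (a ∷ α) β       zero    _         = refl
‼-toggleHead (a ∷ α) β       (suc x) (s≤s x<n) = ‼-toggleHead α β x x<n

‼-toggle-ends : ∀ α c y β x → x < length (α ++ c ∷ y ∷ β) →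
  (α ++ not c ∷ y ∷ toggleHead β) ‼ x
  ≡ toggleAt (length α) (toggleAt (suc (suc (length α))) ((α ++ c ∷ y ∷ β) ‼_)) x
‼-toggle-ends []      c y β       zero                _ = refl
‼-toggle-ends []      c y β       (suc zero)          _ = refl
‼-toggle-ends []      c y (b ∷ β) (suc (suc zero))    _ = refl
‼-toggle-ends []      c y []      (suc (suc zero))    (s≤s (s≤s ()))
‼-toggle-ends []      c y []      (suc (suc (suc x))) _ = refl
‼-toggle-ends []      c y (b ∷ β) (suc (suc (suc x))) _ = refl
‼-toggle-ends (a ∷ α) c y β       zero                _ = refl
‼-toggle-ends (a ∷ α) c y β       (suc x)     (s≤s x<n) = ‼-toggle-ends α c y β x x<n

‼-at : ∀ α γ x → (α ++ γ) ‼ (x + length α) ≡ γ ‼ x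
‼-at α γ x = trans (cong ((α ++ γ) ‼_) (ℕ.+-comm x (length α))) (‼-++ α)
  where
  ‼-++ : ∀ α → (α ++ γ) ‼ (length α + x) ≡ γ ‼ x
  ‼-++ []      = refl
  ‼-++ (a ∷ α) = ‼-++ α

length-toggleHead : ∀ β → length (toggleHead β) ≡ length β
length-toggleHead []      = refl
length-toggleHead (b ∷ β) = refl

length-++-cong : ∀ (α : List Bool) {β γ} → length β ≡ length γ → length (α ++ β) ≡ length (α ++ γ)
length-++-cong α {β} {γ} eq = trans (length-++ α) (trans (cong (length α +_) eq) (sym (length-++ α)))

length-++-insert₀₁ : ∀ (α : List Bool) {a b} β → length (α ++ a ∷ b ∷ β) ≡ suc (suc (length (α ++ β)))
length-++-insert₀₁ α {a} {b} β = trans (length-++-sucʳ α a (b ∷ β)) (cong suc (length-++-sucʳ α b β))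

length-++-insert₁₃ : ∀ (α : List Bool) {c a y b} β →
                     length (α ++ c ∷ a ∷ y ∷ b ∷ β) ≡ suc (suc (length (α ++ c ∷ y ∷ β)))
length-++-insert₁₃ []      β = refl
length-++-insert₁₃ (d ∷ α) β = cong suc (length-++-insert₁₃ α β)

length-≤-++-∷∷ : ∀ (α : List Bool) {a b} β → suc (suc (length α)) ≤ length (α ++ a ∷ b ∷ β)
length-≤-++-∷∷ []      β = s≤s (s≤s z≤n)
length-≤-++-∷∷ (d ∷ α) β = s≤s (length-≤-++-∷∷ α β)

flipPath-≼-resize : ∀ {m m′ n n′} (f g : ℕ → Bool) → m ≡ m′ → n ≡ n′ →
                    flipPath m f ≼ flipPath n g → flipPath m′ f ≼ flipPath n′ g
flipPath-≼-resize f g refl refl H≼G = H≼G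

reduce-00ʷ : ∀ α β → wordGraph (α ++ β) ≼ wordGraph (α ++ false ∷ false ∷ β)
reduce-00ʷ α β = flipPath-≼-resize ((α ++ β) ‼_) (w ‼_) refl (sym (length-++-insert₀₁ α β))
  (≼-trans (≼-reflexive (flipPath-cong λ x _ → sym (‼-skip₀₁ α β x)))
           (reduce-00 (w ‼_) (length-++-≤ˡ α) (‼-at α _ 0) (‼-at α _ 1)))
  where
  w : List Bool
  w = α ++ false ∷ false ∷ β

reduce-10ʷ : ∀ α β → wordGraph (α ++ toggleHead β) ≼ wordGraph (α ++ true ∷ false ∷ β)
reduce-10ʷ α β =
  flipPath-≼-resize ((α ++ toggleHead β) ‼_) (w ‼_)
    (sym (length-++-cong α (length-toggleHead β))) (sym (length-++-insert₀₁ α β))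
  (≼-trans (≼-reflexive (flipPath-cong toggled))
           (reduce-10 (w ‼_) (length-++-≤ˡ α) (‼-at α _ 0) (‼-at α _ 1)))
  where
  w : List Bool
  w = α ++ true ∷ false ∷ β
  toggled : ∀ x → x < length (α ++ β) →
            (α ++ toggleHead β) ‼ x ≡ toggleAt (length α) ((w ‼_) ∘ skip₀₁ (length α)) x
  toggled x x<n = trans (‼-toggleHead α β x x<n) (cong ((x ≡ᵇ length α) xor_) (sym (‼-skip₀₁ α β x)))

reduce-1?1ʷ : ∀ α c y β →
  wordGraph (α ++ not c ∷ y ∷ toggleHead β) ≼ wordGraph (α ++ c ∷ true ∷ y ∷ true ∷ β)
reduce-1?1ʷ α c y β =
  flipPath-≼-resize ((α ++ not c ∷ y ∷ toggleHead β) ‼_) (w ‼_)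
    (sym (length-++-cong α (cong (suc ∘ suc) (length-toggleHead β)))) (sym (length-++-insert₁₃ α β))
  (≼-trans (≼-reflexive (flipPath-cong toggled))
           (reduce-1?1 (w ‼_) (length-≤-++-∷∷ α β) (‼-at α _ 1) (‼-at α _ 3)))
  where
  w : List Bool
  w = α ++ c ∷ true ∷ y ∷ true ∷ β
  i : ℕ
  i = length α
  toggled : ∀ x → x < length (α ++ c ∷ y ∷ β) →
            (α ++ not c ∷ y ∷ toggleHead β) ‼ x
            ≡ toggleAt i (toggleAt (suc (suc i)) ((w ‼_) ∘ skip₀₂ (suc i))) x
  toggled x x<n = trans (‼-toggle-ends α c y β x x<n)
    (cong (λ b → (x ≡ᵇ i) xor ((x ≡ᵇ suc (suc i)) xor b)) (sym (‼-skip₀₂ α c y β x)))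

-- The greedy strategy

trues : List Bool → ℕ
trues []          = zero
trues (true ∷ w)  = suc (trues w)
trues (false ∷ w) = trues w

trues-toggleHead : ∀ w → trues w ≤ suc (trues (toggleHead w))
trues-toggleHead []          = z≤n
trues-toggleHead (true ∷ w)  = ℕ.≤-refl
trues-toggleHead (false ∷ w) = ℕ.m≤n⇒m≤1+n (ℕ.n≤1+n (trues w))

replicate-‼ : ∀ P (w : List Bool) x → x < P → (replicate P true ++ w) ‼ x ≡ true
replicate-‼ (suc P) w zero    _         = refl
replicate-‼ (suc P) w (suc x) (s≤s x<P) = replicate-‼ P w x x<P

length-replicate-++ : ∀ P (w : List Bool) → P ≤ length (replicate P true ++ w)
length-replicate-++ zero    w = z≤n
length-replicate-++ (suc P) w = s≤s (length-replicate-++ P w)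

replicate-∷ : ∀ P (w : List Bool) → replicate P true ++ true ∷ w ≡ replicate (suc P) true ++ w
replicate-∷ zero    w = refl
replicate-∷ (suc P) w = cong (true ∷_) (replicate-∷ P w)

enough-trues : ∀ {T P t} → suc P ≤ T → 4 * T ≤ 4 * P + t → 4 ≤ t
enough-trues {T} {P} {t} P<T inv = ℕ.+-cancelˡ-≤ (4 * P) 4 t
  (ℕ.≤-trans (ℕ.≤-reflexive (ℕ.+-comm (4 * P) 4))
    (ℕ.≤-trans (ℕ.≤-reflexive (sym (ℕ.*-suc 4 P))) (ℕ.≤-trans (ℕ.*-monoʳ-≤ 4 P<T) inv)))

fuel-fits : ∀ {fuel} k (w : List Bool) → suc (k + length w) ≤ suc fuel → length w ≤ fuel
fuel-fits k w (s≤s le) = ℕ.≤-trans (ℕ.m≤n+m (length w) k) le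

fuel-fits-toggleHead : ∀ {fuel} k b w → suc (k + suc (length w)) ≤ suc fuel →
                       length (b ∷ toggleHead w) ≤ fuel
fuel-fits-toggleHead {fuel} k b w le =
  subst (_≤ fuel) (cong suc (sym (length-toggleHead w))) (fuel-fits k (b ∷ w) le)

toggle-slack : ∀ k w → trues w ≤ k + suc (trues (toggleHead w))
toggle-slack k w = ℕ.≤-trans (trues-toggleHead w) (ℕ.m≤n+m _ k)

module _ (T : ℕ) where

  Reaches : List Bool → Set
  Reaches w = coPath T ≼ wordGraph w

  Budget : ℕ → List Bool → Set
  Budget P w = 4 * T ≤ 4 * P + trues w

  absorb : ∀ P k w w′ → trues w ≤ 4 * k + trues w′ → Budget P w → Budget (k + P) w′
  absorb P k w w′ w≤w′ inv =
    ℕ.≤-trans inv (ℕ.≤-trans (ℕ.+-monoʳ-≤ (4 * P) w≤w′) (ℕ.≤-reflexive eq))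
    where
    open +-*-Solver
    eq : 4 * P + (4 * k + trues w′) ≡ 4 * (k + P) + trues w′
    eq = solve 3 (λ k P t → con 4 :* P :+ (con 4 :* k :+ t) := con 4 :* (k :+ P) :+ t)
               refl k P (trues w′)

  via-00 : ∀ α γ β → Reaches (α ++ γ ++ β) → Reaches (α ++ γ ++ false ∷ false ∷ β)
  via-00 α γ β r = subst Reaches (++-assoc α γ _)
    (≼-trans (subst Reaches (sym (++-assoc α γ β)) r) (reduce-00ʷ (α ++ γ) β))

  via-10 : ∀ α γ β → Reaches (α ++ γ ++ toggleHead β) → Reaches (α ++ γ ++ true ∷ false ∷ β)
  via-10 α γ β r = subst Reaches (++-assoc α γ _)
    (≼-trans (subst Reaches (sym (++-assoc α γ _)) r) (reduce-10ʷ (α ++ γ) β))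

  via-1?1 : ∀ α γ c y β → Reaches (α ++ γ ++ not c ∷ y ∷ toggleHead β) →
            Reaches (α ++ γ ++ c ∷ true ∷ y ∷ true ∷ β)
  via-1?1 α γ c y β r = subst Reaches (++-assoc α γ _)
    (≼-trans (subst Reaches (sym (++-assoc α γ _)) r) (reduce-1?1ʷ (α ++ γ) c y β))

  block-reaches : ∀ fuel P w → length w ≤ fuel → Budget P w → Reaches (replicate P true ++ w)
  block-reaches-step : ∀ fuel P w → length w ≤ fuel → Budget P w → 4 ≤ trues w →
                       Reaches (replicate P true ++ w)
  block-reaches-01101 : ∀ fuel P w → length (false ∷ true ∷ true ∷ false ∷ true ∷ w) ≤ suc fuel →
                        Budget P (false ∷ true ∷ true ∷ false ∷ true ∷ w) → 1 ≤ trues w →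
                        Reaches (replicate P true ++ false ∷ true ∷ true ∷ false ∷ true ∷ w)

  block-reaches fuel P w bound inv with T ≤? P
  ... | yes T≤P = coPath-≼-flipPath (ℕ.≤-trans T≤P (length-replicate-++ P w))
                                     (λ x x<T → replicate-‼ P w x (ℕ.≤-trans x<T T≤P))
  ... | no  T≰P = block-reaches-step fuel P w bound inv (enough-trues (ℕ.≰⇒> T≰P) inv)

  block-reaches-step (suc fuel) P (true ∷ w) bound inv _ =
    subst Reaches (sym (replicate-∷ P w))
      (block-reaches fuel (suc P) w (fuel-fits 0 w bound)
        (absorb P 1 (true ∷ w) w (ℕ.+-monoʳ-≤ 1 (ℕ.m≤n+m _ 3)) inv))
  block-reaches-step (suc fuel) P (false ∷ false ∷ w) bound inv _ =
    via-00 (replicate P true) [] w (block-reaches fuel P w (fuel-fits 1 w bound) inv)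
  block-reaches-step (suc fuel) P (false ∷ true ∷ y ∷ true ∷ w) bound inv _ =
    via-1?1 (replicate P true) [] false y w (subst Reaches (sym (replicate-∷ P w′))
      (block-reaches fuel (suc P) w′ (fuel-fits-toggleHead 2 y w bound)
        (absorb P 1 (false ∷ true ∷ y ∷ true ∷ w) w′ (count y) inv)))
    where
    w′ : List Bool
    w′ = y ∷ toggleHead w
    count : ∀ y → trues (false ∷ true ∷ y ∷ true ∷ w) ≤ 4 * 1 + trues (y ∷ toggleHead w)
    count true  = ℕ.+-monoʳ-≤ 3 (toggle-slack 1 w)
    count false = ℕ.+-monoʳ-≤ 2 (toggle-slack 1 w)
  block-reaches-step (suc fuel) P (false ∷ true ∷ false ∷ false ∷ w) bound inv _ =
    via-00 (replicate P true) (false ∷ true ∷ []) w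
      (block-reaches fuel P w′ (fuel-fits 1 w′ bound) inv)
    where
    w′ : List Bool
    w′ = false ∷ true ∷ w
  block-reaches-step (suc fuel) P (false ∷ true ∷ true ∷ false ∷ false ∷ w) bound inv _ =
    via-00 (replicate P true) (false ∷ true ∷ true ∷ []) w
      (block-reaches fuel P w′ (fuel-fits 1 w′ bound) inv)
    where
    w′ : List Bool
    w′ = false ∷ true ∷ true ∷ w
  block-reaches-step (suc fuel) P (false ∷ true ∷ true ∷ false ∷ true ∷ w) bound inv
                     (s≤s (s≤s (s≤s one))) = block-reaches-01101 fuel P w bound inv one
  block-reaches-step _    _ []                                _ _ ()
  block-reaches-step zero _ (_ ∷ _)                         () _ _
  block-reaches-step _    _ (false ∷ [])                      _ _ ()
  block-reaches-step _    _ (false ∷ true ∷ [])               _ _ (s≤s ())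
  block-reaches-step _    _ (false ∷ true ∷ false ∷ [])       _ _ (s≤s ())
  block-reaches-step _    _ (false ∷ true ∷ true ∷ [])        _ _ (s≤s (s≤s ()))
  block-reaches-step _    _ (false ∷ true ∷ true ∷ false ∷ []) _ _ (s≤s (s≤s ()))

  block-reaches-01101 fuel P (false ∷ false ∷ w) bound inv _ =
    via-00 (replicate P true) (false ∷ true ∷ true ∷ false ∷ true ∷ []) w
      (block-reaches fuel P w′ (fuel-fits 1 w′ bound) inv)
    where
    w′ : List Bool
    w′ = false ∷ true ∷ true ∷ false ∷ true ∷ w
  block-reaches-01101 fuel P (z ∷ true ∷ w) bound inv _ =
    via-1?1 (replicate P true) (false ∷ true ∷ true ∷ []) false z w
      (via-1?1 (replicate P true) [] false true (z ∷ toggleHead w)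
        (subst Reaches (sym (trans (replicate-∷ P _) (replicate-∷ (suc P) w′)))
          (block-reaches fuel (suc (suc P)) w′ (fuel-fits-toggleHead 5 (not z) w bound)
            (absorb P 2 (false ∷ true ∷ true ∷ false ∷ true ∷ z ∷ true ∷ w) w′ (count z) inv))))
    where
    w′ : List Bool
    w′ = not z ∷ toggleHead w
    count : ∀ z → trues (false ∷ true ∷ true ∷ false ∷ true ∷ z ∷ true ∷ w)
                  ≤ 4 * 2 + trues (not z ∷ toggleHead w)
    count true  = ℕ.+-monoʳ-≤ 5 (toggle-slack 2 w)
    count false = ℕ.+-monoʳ-≤ 4 (toggle-slack 4 w)
  block-reaches-01101 fuel P (true ∷ []) bound inv _ =
    via-10 (replicate P true) (false ∷ true ∷ []) (true ∷ true ∷ [])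
      (via-1?1 (replicate P true) [] false false []
        (subst Reaches (sym (replicate-∷ P w′))
          (block-reaches fuel (suc P) w′ (fuel-fits-toggleHead 4 false [] bound)
            (absorb P 1 (false ∷ true ∷ true ∷ false ∷ true ∷ true ∷ []) w′ ℕ.≤-refl inv))))
    where
    w′ : List Bool
    w′ = false ∷ []
  block-reaches-01101 fuel P (true ∷ false ∷ w) bound inv _ =
    via-10 (replicate P true) (false ∷ true ∷ []) (true ∷ true ∷ false ∷ w)
      (via-1?1 (replicate P true) [] false false (false ∷ w)
        (subst Reaches (sym (replicate-∷ P w′))
          (block-reaches fuel (suc P) w′ (fuel-fits-toggleHead 4 false (false ∷ w) bound)
            (absorb P 1 (false ∷ true ∷ true ∷ false ∷ true ∷ true ∷ false ∷ w) w′
                    (ℕ.+-monoʳ-≤ 4 (ℕ.n≤1+n _)) inv))))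
    where
    w′ : List Bool
    w′ = false ∷ true ∷ w
  block-reaches-01101 _ _ []            _ _ ()
  block-reaches-01101 _ _ (false ∷ [])  _ _ ()

trues-++ : ∀ u v → trues (u ++ v) ≡ trues u + trues v
trues-++ []          v = refl
trues-++ (true ∷ u)  v = cong suc (trues-++ u v)
trues-++ (false ∷ u) v = trues-++ u v

trues-reverse : ∀ w → trues (reverse w) ≡ trues w
trues-reverse []      = refl
trues-reverse (b ∷ w) = begin
  trues (reverse (b ∷ w))            ≡⟨ cong trues (unfold-reverse b w) ⟩
  trues (reverse w ++ b ∷ [])        ≡⟨ trues-++ (reverse w) (b ∷ []) ⟩
  trues (reverse w) + trues (b ∷ []) ≡⟨ cong (_+ trues (b ∷ [])) (trues-reverse w) ⟩
  trues w + trues (b ∷ [])           ≡⟨ ℕ.+-comm (trues w) _ ⟩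
  trues (b ∷ []) + trues w           ≡⟨ sym (trues-++ (b ∷ []) w) ⟩
  trues (b ∷ w)                      ∎
  where open ≡-Reasoning

trues≤length : ∀ w → trues w ≤ length w
trues≤length []          = z≤n
trues≤length (true ∷ w)  = s≤s (trues≤length w)
trues≤length (false ∷ w) = ℕ.m≤n⇒m≤1+n (trues≤length w)

‼-++ˡ : ∀ u v x → x < length u → (u ++ v) ‼ x ≡ u ‼ x
‼-++ˡ (b ∷ u) v zero    _         = refl
‼-++ˡ (b ∷ u) v (suc x) (s≤s x<u) = ‼-++ˡ u v x x<u

reverse-‼ : ∀ w t → t < length w → reverse w ‼ (length w ∸ suc t) ≡ w ‼ t
reverse-‼ (b ∷ w) t t<1+w rewrite unfold-reverse b w with t
... | zero   = trans (cong ((reverse w ++ b ∷ []) ‼_) (sym (length-reverse w))) (‼-at (reverse w) (b ∷ []) 0)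
... | suc t′ = trans (‼-++ˡ (reverse w) (b ∷ []) _ in-range) (reverse-‼ w t′ t′<w)
  where
  t′<w : t′ < length w
  t′<w = ℕ.≤-pred t<1+w
  in-range : length w ∸ suc t′ < length (reverse w)
  in-range = subst (length w ∸ suc t′ <_) (sym (length-reverse w)) (ℕ.∸-monoʳ-< (s≤s z≤n) t′<w)

∸-suc-involutive : ∀ {x n} → x < n → n ∸ suc (n ∸ suc x) ≡ x
∸-suc-involutive (s≤s x≤n) = ℕ.m∸[m∸n]≡n x≤n

prefix-split : ∀ ℓ w → ℓ ≤ length w → (∀ x → x < ℓ → w ‼ x ≡ true) →
               replicate ℓ true ++ drop ℓ w ≡ w
prefix-split zero    w       _         _      = refl
prefix-split (suc ℓ) (b ∷ w) (s≤s ℓ≤w) prefix =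
  cong₂ _∷_ (sym (prefix 0 (s≤s z≤n))) (prefix-split ℓ w ℓ≤w (λ x x<ℓ → prefix (suc x) (s≤s x<ℓ)))

coPath-≼-word : ∀ ℓ m w → (∀ x → x < ℓ → w ‼ x ≡ true) → ℓ + 4 * m ≤ trues w →
                coPath (ℓ + m) ≼ wordGraph w
coPath-≼-word ℓ m w prefix enough =
  subst (Reaches (ℓ + m)) (prefix-split ℓ w ℓ≤w prefix)
        (block-reaches (ℓ + m) (length rest) ℓ rest ℕ.≤-refl budget)
  where
  rest : List Bool
  rest = drop ℓ w
  ℓ≤w : ℓ ≤ length w
  ℓ≤w = ℕ.≤-trans (ℕ.m≤m+n ℓ (4 * m)) (ℕ.≤-trans enough (trues≤length w))
  trues-w : trues w ≡ ℓ + trues rest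
  trues-w = begin
    trues w                                ≡⟨ cong trues (sym (prefix-split ℓ w ℓ≤w prefix)) ⟩
    trues (replicate ℓ true ++ rest)       ≡⟨ trues-++ (replicate ℓ true) rest ⟩
    trues (replicate ℓ true) + trues rest  ≡⟨ cong (_+ trues rest) (trues-replicate ℓ) ⟩
    ℓ + trues rest                         ∎
    where
    open ≡-Reasoning
    trues-replicate : ∀ ℓ → trues (replicate ℓ true) ≡ ℓ
    trues-replicate zero    = refl
    trues-replicate (suc ℓ) = cong suc (trues-replicate ℓ)
  budget : 4 * (ℓ + m) ≤ 4 * ℓ + trues rest
  budget = ℕ.≤-trans (ℕ.≤-reflexive (ℕ.*-distribˡ-+ 4 ℓ m))
    (ℕ.+-monoʳ-≤ (4 * ℓ) (ℕ.+-cancelˡ-≤ ℓ _ _ (ℕ.≤-trans enough (ℕ.≤-reflexive trues-w))))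

coPath-≼-reverse : ∀ {T} w → coPath T ≼ wordGraph (reverse w) → coPath T ≼ wordGraph w
coPath-≼-reverse {T} w rev =
  ≼-trans (≼-reflexive coPath-symmetric)
    (≼-trans (≼-reverse (subst (λ N → coPath T ≼ flipPath N (reverse w ‼_)) (length-reverse w) rev))
             (≼-reflexive (reverse-flipPath {f = reverse w ‼_} {g = w ‼_} λ i → sym (reversed-‼ i))))
  where
  reversed-‼ : ∀ (i : Fin (length w)) → reverse w ‼ toℕ (opposite i) ≡ w ‼ toℕ i
  reversed-‼ i = trans (cong (reverse w ‼_) (opposite-prop i)) (reverse-‼ w (toℕ i) (toℕ<n i))
  all-true : ∀ x → x < T → true ≡ true
  all-true _ _ = refl
  coPath-symmetric : coPath T ≈ reverseᴳ (coPath T)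
  coPath-symmetric i j = begin
    coPath T i j
      ≡⟨ coPath≈flipPath all-true i j ⟩
    flipPath T (λ _ → true) i j
      ≡⟨ sym (reverse-flipPath {f = λ _ → true} (λ _ → refl) i j) ⟩
    flipPath T (λ _ → true) (opposite i) (opposite j)
      ≡⟨ sym (coPath≈flipPath all-true (opposite i) (opposite j)) ⟩
    coPath T (opposite i) (opposite j) ∎
    where open ≡-Reasoning

lookup-‼ : ∀ {n} (X : Subset n) i → lookup X i ≡ toList X ‼ toℕ i
lookup-‼ (b Vec.∷ X) Fin.zero    = refl
lookup-‼ (b Vec.∷ X) (Fin.suc i) = lookup-‼ X i

∣∣≡trues : ∀ {n} (X : Subset n) → ∣ X ∣ ≡ trues (toList X)
∣∣≡trues Vec.[]          = refl
∣∣≡trues (true Vec.∷ X)  = cong suc (∣∣≡trues X)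
∣∣≡trues (false Vec.∷ X) = ∣∣≡trues X

flip-path≈flipPath : ∀ {n} (X : Subset n) → flip (pathGraph n) X ≈ flipPath n (toList X ‼_)
flip-path≈flipPath X i j rewrite lookup-‼ X i | lookup-‼ X j = refl

∈⇒‼ : ∀ {n} (X : Subset n) {x} (x<n : x < n) → fromℕ< x<n ∈ X → toList X ‼ x ≡ true
∈⇒‼ X x<n x∈X =
  trans (sym (trans (lookup-‼ X _) (cong (toList X ‼_) (toℕ-fromℕ< x<n)))) ([]=⇒lookup x∈X)

first-‼ : ∀ {n ℓ} (X : Subset n) → ℓ ≤ n → (∀ (i : Fin n) → toℕ i < ℓ → i ∈ X) →
          ∀ x → x < ℓ → toList X ‼ x ≡ true
first-‼ X ℓ≤n first x x<ℓ = ∈⇒‼ X x<n (first _ (subst (_< _) (sym (toℕ-fromℕ< x<n)) x<ℓ))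
  where
  x<n : x < _
  x<n = ℕ.≤-trans x<ℓ ℓ≤n

last-‼ : ∀ {n ℓ} (X : Subset n) → ℓ ≤ n → (∀ (i : Fin n) → n ∸ ℓ ≤ toℕ i → i ∈ X) →
         ∀ x → x < ℓ → reverse (toList X) ‼ x ≡ true
last-‼ {n} {ℓ} X ℓ≤n last x x<ℓ = begin
  reverse w ‼ x                  ≡⟨ cong (reverse w ‼_) (sym mirror) ⟩
  reverse w ‼ (length w ∸ suc t) ≡⟨ reverse-‼ w t (subst (t <_) (sym (length-toList X)) t<n) ⟩
  w ‼ t                          ≡⟨ ∈⇒‼ X t<n (last _ t-late) ⟩
  true                           ∎
  where
  open ≡-Reasoning
  w : List Bool
  w = toList X
  x<n : x < n
  x<n = ℕ.≤-trans x<ℓ ℓ≤n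
  t : ℕ
  t = n ∸ suc x
  t<n : t < n
  t<n = ℕ.∸-monoʳ-< (s≤s z≤n) x<n
  t-late : n ∸ ℓ ≤ toℕ (fromℕ< t<n)
  t-late = subst (n ∸ ℓ ≤_) (sym (toℕ-fromℕ< t<n)) (ℕ.∸-monoʳ-≤ n x<ℓ)
  mirror : length w ∸ suc t ≡ x
  mirror = trans (cong (_∸ suc t) (length-toList X)) (∸-suc-involutive x<n)

≼⇒isomorphic-pivot-minor : ∀ {k n} {K : Graph k} {G : Graph n} → K ≼ G →
  Σ ℕ λ k′ → Σ (Graph k′) λ H → PivotMinor H G × Isomorphic H K
≼⇒isomorphic-pivot-minor (H , H≤G , H≈K) = _ , H , H≤G , ↔-id _ , λ x y → sym (H≈K x y)

lemma4p5 : (n : ℕ) (X : Subset n) (ℓ m : ℕ) → 1 ≤ ℓ →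
    ((∀ (i : Fin n) → toℕ i < ℓ → i ∈ X) ⊎ (∀ (i : Fin n) → n ∸ ℓ ≤ toℕ i → i ∈ X)) →
    ∣ X ∣ ≥ ℓ + 4 * m →
    Σ ℕ λ k → Σ (Graph k) λ H →
    PivotMinor H (flip (pathGraph n) X) × Isomorphic H (coPath (ℓ + m))
lemma4p5 n X ℓ m _ ends enough = ≼⇒isomorphic-pivot-minor (≼-trans
  (subst (λ N → coPath (ℓ + m) ≼ flipPath N (w ‼_)) (length-toList X) ([ from-first , from-last ]′ ends))
  (≼-reflexive (λ i j → sym (flip-path≈flipPath X i j))))
  where
  w : List Bool
  w = toList X
  ℓ≤n : ℓ ≤ n
  ℓ≤n = ℕ.≤-trans (ℕ.m≤m+n ℓ (4 * m)) (ℕ.≤-trans enough (∣p∣≤n X))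
  enough′ : ℓ + 4 * m ≤ trues w
  enough′ = ℕ.≤-trans enough (ℕ.≤-reflexive (∣∣≡trues X))
  from-first : (∀ (i : Fin n) → toℕ i < ℓ → i ∈ X) → coPath (ℓ + m) ≼ wordGraph w
  from-first first = coPath-≼-word ℓ m w (first-‼ X ℓ≤n first) enough′
  from-last : (∀ (i : Fin n) → n ∸ ℓ ≤ toℕ i → i ∈ X) → coPath (ℓ + m) ≼ wordGraph w
  from-last last = coPath-≼-reverse w (coPath-≼-word ℓ m (reverse w) (last-‼ X ℓ≤n last)
                                        (subst (ℓ + 4 * m ≤_) (sym (trues-reverse w)) enough′))
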